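{- In the setting described in the context, there exists a right transversal of $E$ in $K$ consisting of the identity and involutions.
   Context: Let $p\geq5$ be a prime and $G\leq\mathrm{Sym}(\Omega)$ transitive with $|\Omega|=3p$, whose only non-trivial $G$-invariant partition is $\mathcal{B}=\{B_1,\dots,B_p\}$ with $|B_i|=3$. Let $\overline{G}\leq\mathrm{Sym}(\mathcal{B})$ be the induced group and $K=\ker(G\to\overline{G})$ (elements fixing every block setwise). Assume $K\neq1$, $K$ contains no derangement, every minimal normal subgroup of $G$ contained in $K$ is an elementary abelian $3$-group, $\overline{G}$ is solvable, and $K$ contains an involution. Let $E$ be the subgroup of $K$ generated by all elements of order $3$ in $K$. -}

module Defs where

open import Level using (0ℓ)
open import Data.Nat using (ℕ; suc; _*_; _≥_)
open import Data.Nat.Primality using (Prime)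
open import Data.Fin using (Fin; zero; fromℕ; inject₁; suc)
open import Data.Fin.Permutation using (Permutation′; _⟨$⟩ʳ_; _∘ₚ_; flip) renaming (id to idₚ)
open import Data.List using (List; length; filter)
open import Data.List.Membership.Propositional using (_∈_)
open import Data.Product using (Σ; ∃; ∃-syntax; _×_; _,_)
open import Data.Sum using (_⊎_)
open import Relation.Nullary using (¬_; Dec)
open import Relation.Binary using (IsEquivalence)
open import Relation.Binary.PropositionalEquality using (_≡_)
open import Data.Fin using (_≟_)
open import Data.List using (allFin) public

-- Permutations of Fin n.  Product convention: a · b = "first a, then b"
-- (right action, x^(ab) = (x^a)^b), which is stdlib's _∘ₚ_.

Perm : ℕ → Set
Perm = Permutation′

infixl 7 _·_
_·_ : ∀ {n} → Perm n → Perm n → Perm n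
a · b = a ∘ₚ b

_⁻¹ : ∀ {n} → Perm n → Perm n
a ⁻¹ = flip a

one : ∀ {n} → Perm n
one = idₚ

infix 4 _≈_
_≈_ : ∀ {n} → Perm n → Perm n → Set
a ≈ b = ∀ x → a ⟨$⟩ʳ x ≡ b ⟨$⟩ʳ x

record Subgroup (n : ℕ) : Set₁ where
  field
    mem     : Perm n → Set
    mem-≈   : ∀ {a b} → a ≈ b → mem a → mem b
    mem-one : mem one
    mem-·   : ∀ {a b} → mem a → mem b → mem (a · b)
    mem-⁻¹  : ∀ {a} → mem a → mem (a ⁻¹)
open Subgroup public

_⊆_ : ∀ {n} → Subgroup n → Subgroup n → Set
H ⊆ L = ∀ {a} → mem H a → mem L a

_≐_ : ∀ {n} → Subgroup n → Subgroup n → Set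
H ≐ L = (H ⊆ L) × (L ⊆ H)

IsTrivial : ∀ {n} → Subgroup n → Set
IsTrivial H = ∀ {a} → mem H a → a ≈ one

_⊴_ : ∀ {n} → Subgroup n → Subgroup n → Set
H ⊴ L = (H ⊆ L) × (∀ {h g} → mem H h → mem L g → mem H (g ⁻¹ · h · g))

AbelianQuotient : ∀ {n} → Subgroup n → Subgroup n → Set
AbelianQuotient L H = ∀ {a b} → mem L a → mem L b → mem H (a ⁻¹ · b ⁻¹ · a · b)

IsSolvable : ∀ {n} → Subgroup n → Set₁
IsSolvable {n} H =
  Σ ℕ λ k → Σ (Fin (suc k) → Subgroup n) λ S →
    IsTrivial (S zero) × (S (fromℕ k) ≐ H) ×
    (∀ (i : Fin k) → (S (inject₁ i) ⊴ S (suc i)) × AbelianQuotient (S (suc i)) (S (inject₁ i)))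

IsAbelian : ∀ {n} → Subgroup n → Set
IsAbelian H = ∀ {a b} → mem H a → mem H b → a · b ≈ b · a

IsElementaryAbelian3 : ∀ {n} → Subgroup n → Set
IsElementaryAbelian3 H = IsAbelian H × (∀ {a} → mem H a → a · a · a ≈ one)

IsMinimalNormal : ∀ {n} → Subgroup n → Subgroup n → Set₁
IsMinimalNormal N G =
  (N ⊴ G) × ¬ IsTrivial N ×
  (∀ (M : Subgroup _) → M ⊴ G → M ⊆ N → IsTrivial M ⊎ (M ≐ N))

IsInvolution : ∀ {n} → Perm n → Set
IsInvolution a = ¬ (a ≈ one) × (a · a ≈ one)

HasOrder3 : ∀ {n} → Perm n → Set
HasOrder3 a = ¬ (a ≈ one) × (a · a · a ≈ one)

IsDerangement : ∀ {n} → Perm n → Set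
IsDerangement a = ∀ x → ¬ (a ⟨$⟩ʳ x ≡ x)

IsTransitive : ∀ {n} → Subgroup n → Set
IsTransitive G = ∀ x y → ∃[ g ] (mem G g × g ⟨$⟩ʳ x ≡ y)

IsInvariantPartition : ∀ {n} → Subgroup n → (Fin n → Fin n → Set) → Set
IsInvariantPartition G R =
  IsEquivalence R × (∀ {g x y} → mem G g → R x y → R (g ⟨$⟩ʳ x) (g ⟨$⟩ʳ y))

IsTrivialPartition : ∀ {n} → (Fin n → Fin n → Set) → Set
IsTrivialPartition R = (∀ x y → R x y → x ≡ y) ⊎ (∀ x y → R x y)

SameBlock : ∀ {n m} → (Fin n → Fin m) → Fin n → Fin n → Set
SameBlock b x y = b x ≡ b y

blockSize : ∀ {n m} → (Fin n → Fin m) → Fin m → ℕ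
blockSize b i = length (filter (λ x → b x ≟ i) (allFin _))

Kernel : ∀ {n m} → Subgroup n → (Fin n → Fin m) → Subgroup n
Kernel G b = record
  { mem = λ g → mem G g × (∀ x → b (g ⟨$⟩ʳ x) ≡ b x)
  ; mem-≈ = λ {a} {c} e (ga , ka) → mem-≈ G e ga , λ x → helper {a} {c} e ka x
  ; mem-one = mem-one G , λ x → _≡_.refl
  ; mem-· = λ {a} {c} (ga , ka) (gc , kc) → mem-· G ga gc , λ x → trans (kc (a ⟨$⟩ʳ x)) (ka x)
  ; mem-⁻¹ = λ {a} (ga , ka) → mem-⁻¹ G ga , λ x → inv a ka x
  }
  where
  open import Relation.Binary.PropositionalEquality using (trans; sym; cong; subst)
  open import Data.Fin.Permutation using (inverseʳ)
  helper : ∀ {a c} → a ≈ c → (∀ x → b (a ⟨$⟩ʳ x) ≡ b x) → ∀ x → b (c ⟨$⟩ʳ x) ≡ b x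
  helper e ka x = trans (cong b (sym (e x))) (ka x)
  inv : ∀ a → (∀ x → b (a ⟨$⟩ʳ x) ≡ b x) → ∀ x → b ((a ⁻¹) ⟨$⟩ʳ x) ≡ b x
  inv a ka x = sym (trans (cong b (sym (inverseʳ a))) (ka _))

InducedMem : ∀ {n m} → Subgroup n → (Fin n → Fin m) → Perm m → Set
InducedMem G b σ = ∃[ g ] (mem G g × (∀ x → b (g ⟨$⟩ʳ x) ≡ σ ⟨$⟩ʳ b x))

data GenOrd3 {n} (K : Subgroup n) : Perm n → Set where
  gen  : ∀ {a} → mem K a → HasOrder3 a → GenOrd3 K a
  g-≈  : ∀ {a c} → a ≈ c → GenOrd3 K a → GenOrd3 K c
  g-1  : GenOrd3 K one
  g-·  : ∀ {a c} → GenOrd3 K a → GenOrd3 K c → GenOrd3 K (a · c)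
  g-⁻¹ : ∀ {a} → GenOrd3 K a → GenOrd3 K (a ⁻¹)

Ord3Generated : ∀ {n} → Subgroup n → Subgroup n
Ord3Generated K = record
  { mem = GenOrd3 K ; mem-≈ = g-≈ ; mem-one = g-1 ; mem-· = g-· ; mem-⁻¹ = g-⁻¹ }

IsRightTransversal : ∀ {n} → Subgroup n → Subgroup n → List (Perm n) → Set
IsRightTransversal E K T =
  (∀ {t} → t ∈ T → mem K t) ×
  (∀ {k} → mem K k → ∃[ t ] (t ∈ T × ∃[ e ] (mem E e × k ≈ e · t))) ×
  (∀ {t t′} → t ∈ T → t′ ∈ T → ∃[ e ] (mem E e × t′ ≈ e · t) → t ≈ t′)

Induced : ∀ {n m} → Subgroup n → (Fin n → Fin m) → Subgroup m
Induced G b = record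
  { mem = InducedMem G b
  ; mem-≈ = λ {σ} {τ} e (g , gG , hg) → g , gG , λ x → trans (hg x) (e (b x))
  ; mem-one = one , mem-one G , λ x → refl
  ; mem-· = λ {σ} {τ} (g , gG , hg) (h , hG , hh) →
      g · h , mem-· G gG hG , λ x → trans (hh (g ⟨$⟩ʳ x)) (cong (τ ⟨$⟩ʳ_) (hg x))
  ; mem-⁻¹ = λ {σ} (g , gG , hg) → g ⁻¹ , mem-⁻¹ G gG , λ x →
      trans (sym (inverseˡ σ)) (cong (σ ⁻¹ ⟨$⟩ʳ_) (trans (sym (hg _)) (cong b (inverseʳ g))))
  }
  where
  open import Relation.Binary.PropositionalEquality using (trans; sym; cong; refl)
  open import Data.Fin.Permutation using (inverseʳ; inverseˡ)

module Submission where

-- Each element of K permutes the three points of every block, so K embeds in S₃ × ⋯ × S₃.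
-- Hence k⁶ = 1 for all k ∈ K, and since the elements of S₃ of order dividing 3 form the
-- subgroup A₃, the group E generated by the elements of order 3 of K is {k ∈ K | k³ = 1}.
-- So every k ∈ K lies in the coset E k³ of the element k³, which squares to 1; as K is
-- finite and membership in E is decidable, keeping one cube from each coset gives the
-- transversal.

open import Defs
open import Data.Empty using (⊥-elim)
open import Data.Fin.Base using (Fin; zero; suc; punchIn)
open import Data.Fin.Patterns using (0F; 1F; 2F)
open import Data.Fin.Permutation
  using (_⟨$⟩ʳ_; _⟨$⟩ˡ_; inverseʳ; inverseˡ; insert; remove; insert-remove)
open import Data.Fin.Properties using (_≟_; all?)
open import Data.List.Base
  using (List; []; _∷_; [_]; allFin; length; cartesianProductWith; deduplicate; filter; lookup; map)
open import Data.List.Membership.Propositional using (_∈_; find; lose)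
open import Data.List.Membership.Propositional.Properties
  using (∈-allFin; ∈-cartesianProductWith⁺; ∈-filter⁺; ∈-filter⁻; ∈-lookup; ∈-map⁺)
open import Data.List.Relation.Unary.All as All using (All; []; _∷_)
import Data.List.Relation.Unary.All.Properties as All
open import Data.List.Relation.Unary.AllPairs using (AllPairs; []; _∷_)
import Data.List.Relation.Unary.AllPairs.Properties as AllPairs
open import Data.List.Relation.Unary.Any using (Any; here; there; index)
import Data.List.Relation.Unary.Any.Properties as Any
open import Data.List.Relation.Unary.Unique.Propositional using (Unique)
import Data.List.Relation.Unary.Unique.Propositional.Properties as Unique
open import Data.Nat.Base using (ℕ; zero; suc; _*_; _≥_)
open import Data.Nat.GeneralisedArithmetic using (iterate)
open import Data.Nat.Primality using (Prime)
open import Data.Product using (∃-syntax; _×_; _,_; proj₁; proj₂; uncurry)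
open import Data.Sum using (_⊎_; inj₁; inj₂)
import Data.Vec.Functional as Vector
open import Function.Base using (_∘_)
open import Function.Bundles using (Injection)
open import Function.Definitions using (Injective)
open import Function.Properties.Inverse using (↔⇒↣)
open import Level using (0ℓ)
open import Relation.Binary.Core using (Rel)
open import Relation.Binary.Definitions using (Symmetric; Decidable)
open import Relation.Binary.PropositionalEquality
  using (_≡_; _≗_; refl; sym; trans; cong; subst; module ≡-Reasoning)
open import Relation.Nullary using (¬_; Dec; yes; no)
open import Relation.Nullary.Decidable using (map′; ¬?; _×-dec_; _→-dec_; from-yes)

private
  variable
    n : ℕ

infix 4 _≈?_
_≈?_ : (a c : Perm n) → Dec (a ≈ c)
a ≈? c = all? λ x → a ⟨$⟩ʳ x ≟ c ⟨$⟩ʳ x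

cube : Perm n → Perm n
cube a = a · a · a

cube-cong : {a c : Perm n} → a ≈ c → cube a ≈ cube c
cube-cong {a = a} {c} a≈c x = begin
  a ⟨$⟩ʳ (a ⟨$⟩ʳ (a ⟨$⟩ʳ x)) ≡⟨ cong (λ u → a ⟨$⟩ʳ (a ⟨$⟩ʳ u)) (a≈c x) ⟩
  a ⟨$⟩ʳ (a ⟨$⟩ʳ (c ⟨$⟩ʳ x)) ≡⟨ cong (a ⟨$⟩ʳ_) (a≈c _) ⟩
  a ⟨$⟩ʳ (c ⟨$⟩ʳ (c ⟨$⟩ʳ x)) ≡⟨ a≈c _ ⟩
  c ⟨$⟩ʳ (c ⟨$⟩ʳ (c ⟨$⟩ʳ x)) ∎
  where open ≡-Reasoning

cube-⁻¹ : (a : Perm n) → cube a ≈ one → cube (a ⁻¹) ≈ one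
cube-⁻¹ a a³≈1 x = begin
  a⁻³x                               ≡⟨ sym (a³≈1 a⁻³x) ⟩
  a ⟨$⟩ʳ (a ⟨$⟩ʳ (a ⟨$⟩ʳ a⁻³x))       ≡⟨ cong (λ u → a ⟨$⟩ʳ (a ⟨$⟩ʳ u)) (inverseʳ a) ⟩
  a ⟨$⟩ʳ (a ⟨$⟩ʳ (a ⟨$⟩ˡ (a ⟨$⟩ˡ x))) ≡⟨ cong (a ⟨$⟩ʳ_) (inverseʳ a) ⟩
  a ⟨$⟩ʳ (a ⟨$⟩ˡ x)                   ≡⟨ inverseʳ a ⟩
  x                                   ∎
  where
  open ≡-Reasoning
  a⁻³x : Fin _
  a⁻³x = cube (a ⁻¹) ⟨$⟩ʳ x

square≈one⇒one⊎involution : {t : Perm n} → t · t ≈ one → (t ≈ one) ⊎ IsInvolution t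
square≈one⇒one⊎involution {t = t} t²≈1 with t ≈? one
... | yes t≈1 = inj₁ t≈1
... | no  t≉1 = inj₂ (t≉1 , t²≈1)

insert-cong : ∀ i j {π ρ : Perm n} → π ≈ ρ → insert i j π ≈ insert i j ρ
insert-cong i j π≈ρ k with i ≟ k
... | yes _ = refl
... | no _  = cong (punchIn j) (π≈ρ _)

permutations : ∀ n → List (Perm n)
permutations zero    = [ one ]
permutations (suc n) = cartesianProductWith (insert zero) (allFin (suc n)) (permutations n)

permutations-complete : (σ : Perm n) → ∃[ ρ ] (ρ ∈ permutations n × σ ≈ ρ)
permutations-complete {zero}  σ = one , here refl , λ ()
permutations-complete {suc n} σ with permutations-complete (remove zero σ)
... | ρ , ρ∈ , σ₀≈ρ =
  insert zero (σ ⟨$⟩ʳ zero) ρ ,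
  ∈-cartesianProductWith⁺ (insert zero) (∈-allFin _) ρ∈ ,
  λ k → trans (sym (insert-remove zero σ k)) (insert-cong zero (σ ⟨$⟩ʳ zero) σ₀≈ρ k)

lookup-injective : ∀ {A : Set} {xs : List A} → Unique xs →
                   ∀ {i j} → lookup xs i ≡ lookup xs j → i ≡ j
lookup-injective {xs = _ ∷ _} _          {zero}  {zero}  _  = refl
lookup-injective {xs = _ ∷ _} (x∉ ∷ _)   {zero}  {suc j} eq = ⊥-elim (All.lookup x∉ (∈-lookup j) eq)
lookup-injective {xs = _ ∷ _} (x∉ ∷ _)   {suc i} {zero}  eq = ⊥-elim (All.lookup x∉ (∈-lookup i) (sym eq))
lookup-injective {xs = _ ∷ _} (_ ∷ xs!)  {suc i} {suc j} eq = cong suc (lookup-injective xs! eq)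

module _ {A : Set} {R : Rel A 0ℓ} (R? : Decidable R) where

  deduplicate-unrelated : ∀ xs → AllPairs (λ x y → ¬ R x y) (deduplicate R? xs)
  deduplicate-unrelated []       = []
  deduplicate-unrelated (x ∷ xs) =
    All.all-filter (¬? ∘ R? x) (deduplicate R? xs) ∷
    AllPairs.filter⁺ (¬? ∘ R? x) (deduplicate-unrelated xs)

unrelated⇒≡ : ∀ {A : Set} {R : Rel A 0ℓ} → Symmetric R → ∀ {xs x y} →
              AllPairs (λ x y → ¬ R x y) xs → x ∈ xs → y ∈ xs → R x y → x ≡ y
unrelated⇒≡ _   (_ ∷ _)   (here refl) (here refl) _ = refl
unrelated⇒≡ _   (x≁ ∷ _)  (here refl) (there y∈)  r = ⊥-elim (All.lookup x≁ y∈ r)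
unrelated⇒≡ sym (x≁ ∷ _)  (there x∈)  (here refl) r = ⊥-elim (All.lookup x≁ x∈ (sym r))
unrelated⇒≡ sym (_ ∷ xs!) (there x∈)  (there y∈)  r = unrelated⇒≡ sym xs! x∈ y∈ r

SameRightCoset : Subgroup n → Rel (Perm n) 0ℓ
SameRightCoset E t t′ = ∃[ e ] (mem E e × t′ ≈ e · t)

module _ (E : Subgroup n) where

  ≈⇒SameRightCoset : ∀ {t t′} → t′ ≈ t → SameRightCoset E t t′
  ≈⇒SameRightCoset t′≈t = one , mem-one E , t′≈t

  SameRightCoset-sym : Symmetric (SameRightCoset E)
  SameRightCoset-sym {t} (e , e∈E , t′≈et) =
    e ⁻¹ , mem-⁻¹ E e∈E , λ x → sym (trans (t′≈et _) (cong (t ⟨$⟩ʳ_) (inverseʳ e)))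

  SameRightCoset-trans : ∀ {t t′ t″} →
    SameRightCoset E t t′ → SameRightCoset E t′ t″ → SameRightCoset E t t″
  SameRightCoset-trans {t} (e , e∈E , t′≈et) (e′ , e′∈E , t″≈e′t′) =
    e′ · e , mem-· E e′∈E e∈E , λ x → trans (t″≈e′t′ x) (t′≈et _)

  sameRightCoset? : (∀ g → Dec (mem E g)) → Decidable (SameRightCoset E)
  sameRightCoset? mem? t t′ = map′ to from (mem? (t′ · t ⁻¹))
    where
    to : mem E (t′ · t ⁻¹) → SameRightCoset E t t′
    to t′t⁻¹∈E = t′ · t ⁻¹ , t′t⁻¹∈E , λ x → sym (inverseʳ t)
    from : SameRightCoset E t t′ → mem E (t′ · t ⁻¹)
    from (e , e∈E , t′≈et) =
      mem-≈ E (λ x → sym (trans (cong (t ⟨$⟩ˡ_) (t′≈et x)) (inverseˡ t))) e∈E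

  deduplicate-rightTransversal : (mem? : ∀ g → Dec (mem E g)) (K : Subgroup n) (xs : List (Perm n)) →
    All (mem K) xs → (∀ {k} → mem K k → Any (λ t → SameRightCoset E t k) xs) →
    IsRightTransversal E K (deduplicate (sameRightCoset? mem?) xs)
  deduplicate-rightTransversal mem? K xs xs⊆K covers =
    (λ t∈T → All.lookup xs⊆K (Any.deduplicate⁻ R? t∈T)) ,
    (λ {k} k∈K → find (Any.deduplicate⁺ R? (λ {t} {t′} → SameRightCoset-trans {t′} {t} {k})
                                          (covers k∈K))) ,
    λ t∈T t′∈T r x → cong (_⟨$⟩ʳ x) (separated t∈T t′∈T r)
    where
    R? : Decidable (SameRightCoset E)
    R? = sameRightCoset? mem?
    separated : ∀ {t t′} → t ∈ deduplicate R? xs → t′ ∈ deduplicate R? xs →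
                SameRightCoset E t t′ → t ≡ t′
    separated = unrelated⇒≡ (λ {t} {t′} → SameRightCoset-sym {t} {t′}) (deduplicate-unrelated R? xs)

HasPeriod : ∀ {A : Set} → (A → A) → ℕ → Set
HasPeriod f j = ∀ a → iterate f a j ≡ a

module _ {A : Set} where

  iterate-cong : ∀ {f g : A → A} → f ≗ g → ∀ a j → iterate f a j ≡ iterate g a j
  iterate-cong     f≗g a zero    = refl
  iterate-cong {f} f≗g a (suc j) =
    trans (cong (λ u → iterate f u j) (f≗g a)) (iterate-cong f≗g _ j)

  HasPeriod-cong : ∀ {f g : A → A} {j} → f ≗ g → HasPeriod f j → HasPeriod g j
  HasPeriod-cong {j = j} f≗g f-per a = trans (sym (iterate-cong f≗g a j)) (f-per a)

iterate-intertwine : ∀ {A B : Set} {h : B → B} {f : A → A} (d : A → B) →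
                     (∀ a → h (d a) ≡ d (f a)) → ∀ a j → iterate h (d a) j ≡ d (iterate f a j)
iterate-intertwine         d hd≡df a zero    = refl
iterate-intertwine {h = h} d hd≡df a (suc j) =
  trans (cong (λ u → iterate h u j) (hd≡df a)) (iterate-intertwine d hd≡df _ j)

-- Every map Fin 3 → Fin 3 agrees with some table a b c, over which both facts are decided
-- exhaustively.
module _ where
  private
    Fun₃ : Set
    Fun₃ = Fin 3 → Fin 3

    table : Fin 3 → Fin 3 → Fin 3 → Fun₃
    table a b c = a Vector.∷ b Vector.∷ c Vector.∷ Vector.[]

    table-≗ : (f : Fun₃) → f ≗ table (f 0F) (f 1F) (f 2F)
    table-≗ f 0F = refl
    table-≗ f 1F = refl
    table-≗ f 2F = refl

    hasPeriod? : (f : Fun₃) (j : ℕ) → Dec (HasPeriod f j)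
    hasPeriod? f j = all? λ a → iterate f a j ≟ a

    injective? : (f : Fun₃) → Dec (∀ k k′ → f k ≡ f k′ → k ≡ k′)
    injective? f = all? λ k → all? λ k′ → (f k ≟ f k′) →-dec (k ≟ k′)

    injective⇒period6-table : ∀ a b c → (∀ k k′ → table a b c k ≡ table a b c k′ → k ≡ k′) →
                              HasPeriod (table a b c) 6
    injective⇒period6-table = from-yes (all? λ a → all? λ b → all? λ c →
      injective? (table a b c) →-dec hasPeriod? (table a b c) 6)

    period3-∘-table : ∀ a b c a′ b′ c′ → HasPeriod (table a b c) 3 → HasPeriod (table a′ b′ c′) 3 →
                      HasPeriod (table a′ b′ c′ ∘ table a b c) 3
    period3-∘-table = from-yes (all? λ a → all? λ b → all? λ c → all? λ a′ → all? λ b′ → all? λ c′ →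
      hasPeriod? (table a b c) 3 →-dec (hasPeriod? (table a′ b′ c′) 3 →-dec
        hasPeriod? (table a′ b′ c′ ∘ table a b c) 3))

  fin3-injective⇒period6 : (f : Fin 3 → Fin 3) → Injective _≡_ _≡_ f → HasPeriod f 6
  fin3-injective⇒period6 f f-inj =
    HasPeriod-cong {f = f′} {j = 6} (λ k → sym (table-≗ f k))
      (injective⇒period6-table (f 0F) (f 1F) (f 2F) tabulated-inj)
    where
    f′ : Fin 3 → Fin 3
    f′ = table (f 0F) (f 1F) (f 2F)
    tabulated-inj : ∀ k k′ → f′ k ≡ f′ k′ → k ≡ k′
    tabulated-inj k k′ e = f-inj (trans (table-≗ f k) (trans e (sym (table-≗ f k′))))

  fin3-period3-∘ : (f g : Fin 3 → Fin 3) → HasPeriod f 3 → HasPeriod g 3 → HasPeriod (g ∘ f) 3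
  fin3-period3-∘ f g f-per g-per =
    HasPeriod-cong {f = g′ ∘ f′} {j = 3} (λ k → sym (trans (table-≗ g (f k)) (cong g′ (table-≗ f k))))
      (period3-∘-table (f 0F) (f 1F) (f 2F) (g 0F) (g 1F) (g 2F)
        (HasPeriod-cong {g = f′} {3} (table-≗ f) f-per) (HasPeriod-cong {g = g′} {3} (table-≗ g) g-per))
    where
    f′ g′ : Fin 3 → Fin 3
    f′ = table (f 0F) (f 1F) (f 2F)
    g′ = table (g 0F) (g 1F) (g 2F)

module Blocks {n m} (b : Fin n → Fin m) where

  BlockPreserving : Perm n → Set
  BlockPreserving x = ∀ y → b (x ⟨$⟩ʳ y) ≡ b y

  record Block (i : Fin m) : Set where
    field
      point       : Fin 3 → Fin n
      point-inj   : Injective _≡_ _≡_ point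
      point-block : ∀ k → b (point k) ≡ i
      point-onto  : ∀ {w} → b w ≡ i → ∃[ k ] (point k ≡ w)

  block : ∀ i → blockSize b i ≡ 3 → Block i
  block i size = fromList _ size (Unique.filter⁺ inBlock? (Unique.allFin⁺ n))
    (λ w∈ → proj₂ (∈-filter⁻ inBlock? {xs = allFin n} w∈)) (λ bw≡i → ∈-filter⁺ inBlock? (∈-allFin _) bw≡i)
    where
    inBlock? : ∀ w → Dec (b w ≡ i)
    inBlock? w = b w ≟ i
    fromList : (ws : List (Fin n)) → length ws ≡ 3 → Unique ws →
               (∀ {w} → w ∈ ws → b w ≡ i) → (∀ {w} → b w ≡ i → w ∈ ws) → Block i
    fromList ws@(_ ∷ _ ∷ _ ∷ []) refl ws! sound complete = record
      { point       = lookup ws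
      ; point-inj   = lookup-injective ws!
      ; point-block = sound ∘ ∈-lookup
      ; point-onto  = λ bw≡i → index (complete bw≡i) , sym (Any.lookup-index (complete bw≡i))
      }

  module Local {i} (B : Block i) (x : Perm n) (x-pres : BlockPreserving x) where
    open Block B

    local : Fin 3 → Fin 3
    local k = proj₁ (point-onto (trans (x-pres (point k)) (point-block k)))

    point-local : ∀ k → x ⟨$⟩ʳ point k ≡ point (local k)
    point-local k = sym (proj₂ (point-onto (trans (x-pres (point k)) (point-block k))))

    local-injective : Injective _≡_ _≡_ local
    local-injective {k} {k′} e = point-inj (Injection.injective (↔⇒↣ x)
      (trans (point-local k) (trans (cong point e) (sym (point-local k′)))))

    iterate-point : ∀ k j → iterate (x ⟨$⟩ʳ_) (point k) j ≡ point (iterate local k j)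
    iterate-point = iterate-intertwine point point-local

    local-period3 : cube x ≈ one → HasPeriod local 3
    local-period3 x³≈1 k = point-inj (trans (sym (iterate-point k 3)) (x³≈1 (point k)))

  module _ (blocks-of-3 : ∀ i → blockSize b i ≡ 3) where
    open Block
    open Local

    period-from-blocks : (x : Perm n) (j : ℕ) →
      (∀ {i} (B : Block i) k → iterate (x ⟨$⟩ʳ_) (point B k) j ≡ point B k) → HasPeriod (x ⟨$⟩ʳ_) j
    period-from-blocks x j per z =
      subst (λ w → iterate (x ⟨$⟩ʳ_) w j ≡ w) (proj₂ z∈B) (per B (proj₁ z∈B))
      where
      B : Block (b z)
      B = block (b z) (blocks-of-3 (b z))
      z∈B : ∃[ k ] (point B k ≡ z)
      z∈B = point-onto B refl

    sixth-power≈one : ∀ x → BlockPreserving x → x · x · x · x · x · x ≈ one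
    sixth-power≈one x x-pres = period-from-blocks x 6 λ B k →
      trans (iterate-point B x x-pres k 6)
            (cong (point B) (fin3-injective⇒period6 (local B x x-pres) (local-injective B x x-pres) k))

    cube≈one-· : ∀ x y → BlockPreserving x → BlockPreserving y →
                 cube x ≈ one → cube y ≈ one → cube (x · y) ≈ one
    cube≈one-· x y x-pres y-pres x³≈1 y³≈1 = period-from-blocks (x · y) 3 λ B k →
      trans (iterate-intertwine {h = (x · y) ⟨$⟩ʳ_} (point B) (point-local-· B) k 3)
            (cong (point B) (fin3-period3-∘ (local B x x-pres) (local B y y-pres)
              (local-period3 B x x-pres x³≈1) (local-period3 B y y-pres y³≈1) k))
      where
      point-local-· : ∀ {i} (B : Block i) k →
        (x · y) ⟨$⟩ʳ point B k ≡ point B (local B y y-pres (local B x x-pres k))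
      point-local-· B k = trans (cong (y ⟨$⟩ʳ_) (point-local B x x-pres k)) (point-local B y y-pres _)

module BlockKernel {n m} (G : Subgroup n) (memG? : ∀ g → Dec (mem G g))
                   (b : Fin n → Fin m) (blocks-of-3 : ∀ i → blockSize b i ≡ 3) where
  open Blocks b

  K E : Subgroup n
  K = Kernel G b
  E = Ord3Generated K

  mem-K? : ∀ a → Dec (mem K a)
  mem-K? a = memG? a ×-dec all? λ y → b (a ⟨$⟩ʳ y) ≟ b y

  -- K lies in S₃ × ⋯ × S₃, so E is K ∩ (A₃ × ⋯ × A₃).
  Ord3Generated⇒cube≈one : ∀ {a} → mem E a → mem K a × cube a ≈ one
  Ord3Generated⇒cube≈one (gen a∈K (_ , a³≈1)) = a∈K , a³≈1
  Ord3Generated⇒cube≈one (g-≈ {a} {c} a≈c a∈E) with Ord3Generated⇒cube≈one a∈E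
  ... | a∈K , a³≈1 = mem-≈ K a≈c a∈K , λ y → trans (sym (cube-cong {a = a} {c} a≈c y)) (a³≈1 y)
  Ord3Generated⇒cube≈one g-1 = mem-one K , λ _ → refl
  Ord3Generated⇒cube≈one (g-· {a} {c} a∈E c∈E)
    with Ord3Generated⇒cube≈one a∈E | Ord3Generated⇒cube≈one c∈E
  ... | a∈K , a³≈1 | c∈K , c³≈1 =
    mem-· K a∈K c∈K , cube≈one-· blocks-of-3 a c (proj₂ a∈K) (proj₂ c∈K) a³≈1 c³≈1
  Ord3Generated⇒cube≈one (g-⁻¹ {a} a∈E) with Ord3Generated⇒cube≈one a∈E
  ... | a∈K , a³≈1 = mem-⁻¹ K a∈K , cube-⁻¹ a a³≈1

  cube≈one⇒Ord3Generated : ∀ {a} → mem K a → cube a ≈ one → mem E a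
  cube≈one⇒Ord3Generated {a} a∈K a³≈1 with a ≈? one
  ... | yes a≈1 = g-≈ (λ y → sym (a≈1 y)) g-1
  ... | no  a≉1 = gen a∈K (a≉1 , a³≈1)

  mem-E? : ∀ a → Dec (mem E a)
  mem-E? a = map′ (uncurry cube≈one⇒Ord3Generated) Ord3Generated⇒cube≈one
                  (mem-K? a ×-dec cube a ≈? one)

  -- k = k⁻² · k³, and k⁻² ∈ E because k⁶ = 1.
  SameRightCoset-cube : ∀ {k} → mem K k → SameRightCoset E (cube k) k
  SameRightCoset-cube {k} k∈K =
    k · cube k ⁻¹ ,
    cube≈one⇒Ord3Generated (mem-· K k∈K (mem-⁻¹ K k³∈K))
      (λ y → trans (cube-cong {a = k · cube k ⁻¹} {k ⁻¹ · k ⁻¹} k·k⁻³≈k⁻² y)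
                   (sixth-power≈one blocks-of-3 (k ⁻¹) (proj₂ (mem-⁻¹ K k∈K)) y)) ,
    λ y → sym (inverseʳ (cube k))
    where
    k³∈K : mem K (cube k)
    k³∈K = mem-· K (mem-· K k∈K k∈K) k∈K
    k·k⁻³≈k⁻² : k · cube k ⁻¹ ≈ k ⁻¹ · k ⁻¹
    k·k⁻³≈k⁻² y = cong (λ u → k ⟨$⟩ˡ (k ⟨$⟩ˡ u)) (inverseˡ k)

  cubes : List (Perm n)
  cubes = map cube (filter mem-K? (permutations n))

  cubes-in-K-involutory : All (λ t → mem K t × t · t ≈ one) cubes
  cubes-in-K-involutory = All.map⁺ (All.map
    (λ {k} k∈K → mem-· K (mem-· K k∈K k∈K) k∈K , sixth-power≈one blocks-of-3 k (proj₂ k∈K))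
    (All.all-filter mem-K? (permutations n)))

  cubes-cover : ∀ {k} → mem K k → Any (λ t → SameRightCoset E t k) cubes
  cubes-cover {k} k∈K with permutations-complete k
  ... | π , π∈ , k≈π = lose (∈-map⁺ cube (∈-filter⁺ mem-K? π∈ π∈K))
    (SameRightCoset-trans E {cube π} {π} {k} (SameRightCoset-cube π∈K) (≈⇒SameRightCoset E {π} {k} k≈π))
    where
    π∈K : mem K π
    π∈K = mem-≈ K k≈π k∈K

  kernel-transversal : ∃[ T ] (IsRightTransversal E K T × (∀ {t} → t ∈ T → (t ≈ one) ⊎ IsInvolution t))
  kernel-transversal =
    deduplicate R? cubes ,
    deduplicate-rightTransversal E mem-E? K cubes (All.map proj₁ cubes-in-K-involutory) cubes-cover ,
    λ {t} t∈T → square≈one⇒one⊎involution {t = t}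
      (proj₂ (All.lookup (All.deduplicate⁺ R? cubes-in-K-involutory) t∈T))
    where
    R? : Decidable (SameRightCoset E)
    R? = sameRightCoset? E mem-E?

lemma8p2 : (p : ℕ) → Prime p → p ≥ 5 →
    (G : Subgroup (3 * p)) → (∀ g → Dec (mem G g)) →
    IsTransitive G →
    (b : Fin (3 * p) → Fin p) →
    (∀ i → blockSize b i ≡ 3) →
    IsInvariantPartition G (SameBlock b) →
    (∀ (R : Fin (3 * p) → Fin (3 * p) → Set) → IsInvariantPartition G R → ¬ IsTrivialPartition R →
      ∀ x y → (R x y → SameBlock b x y) × (SameBlock b x y → R x y)) →
    ¬ IsTrivial (Kernel G b) →
    (∀ {g} → mem (Kernel G b) g → ¬ IsDerangement g) →
    (∀ (N : Subgroup (3 * p)) → IsMinimalNormal N G → N ⊆ Kernel G b → IsElementaryAbelian3 N) →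
    IsSolvable (Induced G b) →
    (∃[ t ] (mem (Kernel G b) t × IsInvolution t)) →
    ∃[ T ] (IsRightTransversal (Ord3Generated (Kernel G b)) (Kernel G b) T ×
            (∀ {t} → t ∈ T → (t ≈ one) ⊎ IsInvolution t))
lemma8p2 p _ _ G memG? _ b blocks-of-3 _ _ _ _ _ _ _ =
  BlockKernel.kernel-transversal G memG? b blocks-of-3
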